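{- An overpartition of $n$ is a non-increasing sequence of positive integers summing to $n$ in which the first occurrence of each distinct value may be overlined (so each value $m$ appears overlined at most once, as $\overline{m}$). For a positive integer $n$, let $\overline{F}_1(n)$ be the total number of parts equal to $1$ or $\overline{1}$ (counted with multiplicity) over all overpartitions of $n$. For a positive integer $k$, let $\overline{G}_k(n)$ be the sum, over all overpartitions $\pi$ of $n$, of the number of values $m$ such that the total number of parts of $\pi$ equal to $m$ or $\overline{m}$ is at least $k$. Then for $n=1,2,\dots$, $$\overline{F}_1(n)=\overline{G}_1(n)-\overline{G}_3(n).$$
   Context: For example, the overpartition $3+2+2+\overline{2}+1+\overline{1}$ of $11$ has the value $2$ occurring three times in total, and this value contributes $1$ to $\overline{G}_k(11)$ for $k=1,2,3$. -}

module Defs where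

open import Data.Nat using (ℕ; zero; suc; _≤_; _≤?_; _≟_)
open import Data.Bool using (Bool; true; false)
open import Data.Product using (_×_; _,_; proj₁; proj₂)
open import Data.List using (List; []; _∷_; map; concatMap; filter; length; upTo; cartesianProduct)
open import Data.Nat.ListAction using (sum)
open import Data.List.Relation.Unary.All using (All; all?)
open import Data.List.Relation.Unary.Linked using (Linked; linked?)
open import Relation.Binary.PropositionalEquality using (_≡_)
open import Relation.Nullary using (Dec; yes; no; ¬_)
open import Relation.Nullary.Decidable using (_×-dec_; _→-dec_; ⌊_⌋)
open import Data.Bool.Properties using () renaming (_≟_ to _≟ᵇ_)

Part : Set
Part = ℕ × Bool

val : Part → ℕ
val = proj₁

over : Part → Bool
over = proj₂

-- Adjacent parts p, q (q follows p): values non-increasing, and an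
-- overlined part must be the first occurrence of its value.
Step : Part → Part → Set
Step p q = (val q ≤ val p) × (val q ≡ val p → over q ≡ false)

step? : ∀ p q → Dec (Step p q)
step? p q = (val q ≤? val p) ×-dec ((val q ≟ val p) →-dec (over q ≟ᵇ false))

IsOverpartition : ℕ → List Part → Set
IsOverpartition n π = All (λ p → 1 ≤ val p) π × Linked Step π × (sum (map val π) ≡ n)

isOverpartition? : ∀ n π → Dec (IsOverpartition n π)
isOverpartition? n π =
  all? (λ p → 1 ≤? val p) π ×-dec (linked? step? π ×-dec (sum (map val π) ≟ n))

listsOfLength : {A : Set} → ℕ → List A → List (List A)
listsOfLength zero xs = [] ∷ []
listsOfLength (suc k) xs = concatMap (λ x → map (x ∷_) (listsOfLength k xs)) xs

candidateParts : ℕ → List Part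
candidateParts n = cartesianProduct (map suc (upTo n)) (true ∷ false ∷ [])

candidates : ℕ → List (List Part)
candidates n = concatMap (λ k → listsOfLength k (candidateParts n)) (upTo (suc n))

overpartitions : ℕ → List (List Part)
overpartitions n = filter (isOverpartition? n) (candidates n)

mult : ℕ → List Part → ℕ
mult m π = length (filter (λ p → val p ≟ m) π)

F1bar : ℕ → ℕ
F1bar n = sum (map (mult 1) (overpartitions n))

-- number of values m occurring at least k times in π (values of parts of an
-- overpartition of n lie in 1..n, and for k ≥ 1 only occurring values count)
bigValues : ℕ → ℕ → List Part → ℕ
bigValues n k π = length (filter (λ m → k ≤? mult m π) (map suc (upTo n)))

Gbar : ℕ → ℕ → ℕ
Gbar k n = sum (map (bigValues n k) (overpartitions n))

-- For a value m let a_k(m, n) be the number of overpartitions of n with at least k parts equal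
-- to m.  Adding or removing a plain copy of m shows a_{k+1}(m, n + m) = a_k(m, n) for k ≥ 1, and
-- inserting or deleting the only part m, overlined or not, shows that the overpartitions of n + m
-- with exactly one part m are twice as many as those of n without m.  Hence
-- a_1(m, n) + a_2(m, n) = 2 p̄(n − m) and a_2(m, n) + a_3(m, n) = 2 p̄(n − 2m), so that
-- Ḡ₁(n) − Ḡ₃(n) = Σ_m (a_1 − a_3)(m, n) = 2 Σ_m (p̄(n − m) − p̄(n − 2m)).  On the other side
-- F̄₁(n) = Σ_{c ≥ 1} a_c(1, n), and the same relations at m = 1 give F̄₁(n) = F̄₁(n − 2) + 2 p̄(n − 1),
-- which is the recursion satisfied by the right-hand side as well.

module Submission where

open import Defs
open import Data.Bool using (true; false; if_then_else_)
import Data.Bool.Properties as Bool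
open import Data.Empty using (⊥-elim)
open import Data.List using (List; []; _∷_; _++_; drop; map; filter; length; upTo; applyUpTo)
open import Data.List.Membership.Propositional using (_∈_; _∉_)
open import Data.List.Membership.Propositional.Properties
  using (∈-∃++; ∈-++⁺ˡ; ∈-++⁺ʳ; ∈-++⁻; ∈-map⁺; ∈-map⁻; ∈-filter⁻; ∈-filter⁺; ∈-upTo⁺; ∈-upTo⁻;
         ∈-concat⁺′; ∈-concat⁻′; ∈-cartesianProduct⁺)
open import Data.List.Properties
  using (map-upTo; map-applyUpTo; applyUpTo-∷ʳ; ∷-injectiveʳ; length-++-sucʳ;
         filter-accept; filter-reject; filter-none; filter-all)
open import Data.List.Relation.Binary.Disjoint.Propositional using (Disjoint)
open import Data.List.Relation.Binary.Permutation.Propositional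
  using (_↭_; ↭-refl; ↭-prep; ↭-swap; ↭-sym; ↭-trans)
open import Data.List.Relation.Binary.Permutation.Propositional.Properties
  using (All-resp-↭; Any-resp-↭; filter-↭; ↭-length) renaming (map⁺ to ↭-map⁺)
open import Data.List.Relation.Unary.All as All using (All; []; _∷_)
import Data.List.Relation.Unary.All.Properties as AllP
open import Data.List.Relation.Unary.AllPairs as AllPairs using ([]; _∷_)
import Data.List.Relation.Unary.AllPairs.Properties as AllPairsP
open import Data.List.Relation.Unary.Any using (here; there)
open import Data.List.Relation.Unary.Linked as Linked using (Linked; []; [-]; _∷_)
open import Data.List.Relation.Unary.Unique.Propositional using (Unique)
import Data.List.Relation.Unary.Unique.Propositional.Properties as Unique
open import Data.Nat using (ℕ; zero; suc; _+_; _*_; _∸_; _≤_; _<_; _≟_; _<?_; _≤?_; z≤n; s≤s; s≤s⁻¹)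
open import Data.Nat.ListAction using (sum)
open import Data.Nat.ListAction.Properties using (sum-++; sum-↭)
open import Data.Nat.Properties
open import Data.Nat.Solver using (module +-*-Solver)
open import Data.Product using (_×_; _,_; proj₁; proj₂; ∃)
open import Data.Product.Properties using (≡-dec)
open import Data.Sum using (_⊎_; inj₁; inj₂)
open import Data.Unit using (⊤; tt)
open import Function using (_∘_)
open import Relation.Binary.PropositionalEquality
open import Relation.Nullary using (Dec; yes; no; ¬_; contradiction; _because_; does; proof; ofʸ; ofⁿ)
open import Relation.Nullary.Decidable using (dec-true; dec-false; _×-dec_; ¬?)
open import Relation.Unary using (Pred; Decidable)

open import Data.List.Membership.DecPropositional (≡-dec _≟_ Bool._≟_) using (_∈?_)
open import Algebra.Properties.CommutativeSemigroup +-commutativeSemigroup using (interchange)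

indicator : ∀ {p} {P : Set p} → Dec P → ℕ
indicator P? = if does P? then 1 else 0

module _ {a} {A : Set a} where

  sum-map-cong : ∀ {f g : A → ℕ} xs → (∀ {x} → x ∈ xs → f x ≡ g x) →
                 sum (map f xs) ≡ sum (map g xs)
  sum-map-cong []       f≡g = refl
  sum-map-cong (x ∷ xs) f≡g = cong₂ _+_ (f≡g (here refl)) (sum-map-cong xs (f≡g ∘ there))

  sum-map-+ : ∀ (f g : A → ℕ) xs →
              sum (map (λ x → f x + g x) xs) ≡ sum (map f xs) + sum (map g xs)
  sum-map-+ f g []       = refl
  sum-map-+ f g (x ∷ xs) = begin
    f x + g x + sum (map (λ x → f x + g x) xs) ≡⟨ cong (f x + g x +_) (sum-map-+ f g xs) ⟩
    f x + g x + (sum (map f xs) + sum (map g xs)) ≡⟨ interchange (f x) (g x) _ _ ⟩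
    f x + sum (map f xs) + (g x + sum (map g xs)) ∎
    where open ≡-Reasoning

  length-filter-indicator : ∀ {p} {P : Pred A p} (P? : Decidable P) xs →
                            length (filter P? xs) ≡ sum (map (indicator ∘ P?) xs)
  length-filter-indicator P? []       = refl
  length-filter-indicator P? (x ∷ xs) with P? x
  ... | yes _ = cong suc (length-filter-indicator P? xs)
  ... | no  _ = length-filter-indicator P? xs

  length-filter-+ : ∀ {p q r} {P : Pred A p} {Q : Pred A q} {R : Pred A r}
                    (P? : Decidable P) (Q? : Decidable Q) (R? : Decidable R) xs →
                    (∀ x → indicator (P? x) ≡ indicator (Q? x) + indicator (R? x)) →
                    length (filter P? xs) ≡ length (filter Q? xs) + length (filter R? xs)
  length-filter-+ P? Q? R? xs split = begin
    length (filter P? xs)                                          ≡⟨ length-filter-indicator P? xs ⟩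
    sum (map (indicator ∘ P?) xs)                                  ≡⟨ sum-map-cong xs (λ {x} _ → split x) ⟩
    sum (map (λ x → indicator (Q? x) + indicator (R? x)) xs)       ≡⟨ sum-map-+ (indicator ∘ Q?) (indicator ∘ R?) xs ⟩
    sum (map (indicator ∘ Q?) xs) + sum (map (indicator ∘ R?) xs) ≡⟨ cong₂ _+_ (length-filter-indicator Q? xs) (length-filter-indicator R? xs) ⟨
    length (filter Q? xs) + length (filter R? xs)                  ∎
    where open ≡-Reasoning

  sum-map-zero : ∀ xs → sum (map (λ (_ : A) → 0) xs) ≡ 0
  sum-map-zero []       = refl
  sum-map-zero (_ ∷ xs) = sum-map-zero xs

module _ {a b} {A : Set a} {B : Set b} where

  sum-map-swap : ∀ (h : A → B → ℕ) xs ys →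
                 sum (map (λ x → sum (map (h x) ys)) xs) ≡ sum (map (λ y → sum (map (λ x → h x y) xs)) ys)
  sum-map-swap h []       ys = sym (sum-map-zero ys)
  sum-map-swap h (x ∷ xs) ys = begin
    sum (map (h x) ys) + sum (map (λ x → sum (map (h x) ys)) xs)
      ≡⟨ cong (sum (map (h x) ys) +_) (sum-map-swap h xs ys) ⟩
    sum (map (h x) ys) + sum (map (λ y → sum (map (λ x → h x y) xs)) ys)
      ≡⟨ sum-map-+ (h x) (λ y → sum (map (λ x → h x y) xs)) ys ⟨
    sum (map (λ y → h x y + sum (map (λ x → h x y) xs)) ys) ∎
    where open ≡-Reasoning

  double-counting : ∀ {r} {R : A → B → Set r} (R? : ∀ x y → Dec (R x y)) xs ys →
                    sum (map (λ x → length (filter (R? x) ys)) xs) ≡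
                    sum (map (λ y → length (filter (λ x → R? x y) xs)) ys)
  double-counting R? xs ys = begin
    sum (map (λ x → length (filter (R? x) ys)) xs)
      ≡⟨ sum-map-cong xs (λ {x} _ → length-filter-indicator (R? x) ys) ⟩
    sum (map (λ x → sum (map (λ y → indicator (R? x y)) ys)) xs)
      ≡⟨ sum-map-swap (λ x y → indicator (R? x y)) xs ys ⟩
    sum (map (λ y → sum (map (λ x → indicator (R? x y)) xs)) ys)
      ≡⟨ sum-map-cong ys (λ {y} _ → length-filter-indicator (λ x → R? x y) xs) ⟨
    sum (map (λ y → length (filter (λ x → R? x y) xs)) ys) ∎
    where open ≡-Reasoning

∑ : ℕ → (ℕ → ℕ) → ℕ
∑ n f = sum (applyUpTo f n)

syntax ∑ n (λ i → e) = ∑[ i < n ] e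

∑-upTo : ∀ n f → ∑ n f ≡ sum (map f (upTo n))
∑-upTo n f = cong sum (sym (map-upTo f n))

sum-map-positives : ∀ n (f : ℕ → ℕ) → sum (map f (map suc (upTo n))) ≡ ∑[ i < n ] f (suc i)
sum-map-positives n f = cong sum (trans (cong (map f) (map-upTo suc n)) (map-applyUpTo suc f n))

∑-cong : ∀ n {f g : ℕ → ℕ} → (∀ {i} → i < n → f i ≡ g i) → ∑ n f ≡ ∑ n g
∑-cong n {f} {g} f≡g = begin
  ∑ n f                 ≡⟨ ∑-upTo n f ⟩
  sum (map f (upTo n))  ≡⟨ sum-map-cong (upTo n) (f≡g ∘ ∈-upTo⁻) ⟩
  sum (map g (upTo n))  ≡⟨ ∑-upTo n g ⟨
  ∑ n g                 ∎
  where open ≡-Reasoning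

∑-+ : ∀ n (f g : ℕ → ℕ) → ∑[ i < n ] (f i + g i) ≡ ∑ n f + ∑ n g
∑-+ n f g = begin
  ∑[ i < n ] (f i + g i)                    ≡⟨ ∑-upTo n _ ⟩
  sum (map (λ i → f i + g i) (upTo n))      ≡⟨ sum-map-+ f g (upTo n) ⟩
  sum (map f (upTo n)) + sum (map g (upTo n)) ≡⟨ cong₂ _+_ (∑-upTo n f) (∑-upTo n g) ⟨
  ∑ n f + ∑ n g                             ∎
  where open ≡-Reasoning

∑-*ˡ : ∀ n k (f : ℕ → ℕ) → ∑[ i < n ] (k * f i) ≡ k * ∑ n f
∑-*ˡ zero    k f = sym (*-zeroʳ k)
∑-*ˡ (suc n) k f = trans (cong (k * f 0 +_) (∑-*ˡ n k (f ∘ suc))) (sym (*-distribˡ-+ k (f 0) _))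

∑-suc : ∀ n f → ∑ (suc n) f ≡ ∑ n f + f n
∑-suc n f = begin
  sum (applyUpTo f (suc n))          ≡⟨ cong sum (applyUpTo-∷ʳ f n) ⟨
  sum (applyUpTo f n ++ f n ∷ [])    ≡⟨ sum-++ (applyUpTo f n) (f n ∷ []) ⟩
  ∑ n f + (f n + 0)                  ≡⟨ cong (∑ n f +_) (+-identityʳ (f n)) ⟩
  ∑ n f + f n                        ∎
  where open ≡-Reasoning

module _ {A : Set} where

  length-∈-listsOfLength : ∀ (xs : List A) k {ys} → ys ∈ listsOfLength k xs → length ys ≡ k
  length-∈-listsOfLength xs zero    (here refl) = refl
  length-∈-listsOfLength xs (suc k) ys∈
    with l , ys∈l , l∈ ← ∈-concat⁻′ (map (λ x → map (x ∷_) (listsOfLength k xs)) xs) ys∈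
    with x , _ , refl ← ∈-map⁻ (λ x → map (x ∷_) (listsOfLength k xs)) l∈
    with zs , zs∈ , refl ← ∈-map⁻ (x ∷_) ys∈l
    = cong suc (length-∈-listsOfLength xs k zs∈)

  ∈-listsOfLength : ∀ (xs : List A) {ys} → All (_∈ xs) ys → ys ∈ listsOfLength (length ys) xs
  ∈-listsOfLength xs []            = here refl
  ∈-listsOfLength xs {y ∷ ys} (y∈ ∷ ys∈) =
    ∈-concat⁺′ (∈-map⁺ (y ∷_) (∈-listsOfLength xs ys∈)) (∈-map⁺ (λ x → map (x ∷_) (listsOfLength (length ys) xs)) y∈)

  unique-listsOfLength : ∀ {xs : List A} → Unique xs → ∀ k → Unique (listsOfLength k xs)
  unique-listsOfLength {xs} _       zero    = [] ∷ []
  unique-listsOfLength {xs} xs-uniq (suc k) = Unique.concat⁺ {xss = map consAll xs}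
    (AllP.map⁺ (All.tabulate λ _ → Unique.map⁺ ∷-injectiveʳ (unique-listsOfLength xs-uniq k)))
    (AllPairsP.map⁺ (AllPairs.map consAll-disjoint xs-uniq))
    where
    consAll : A → List (List A)
    consAll x = map (x ∷_) (listsOfLength k xs)
    consAll-disjoint : ∀ {x y} → x ≢ y → Disjoint (consAll x) (consAll y)
    consAll-disjoint x≢y (v∈x , v∈y) with _ , _ , refl ← ∈-map⁻ _ v∈x | _ , _ , refl ← ∈-map⁻ _ v∈y
      = x≢y refl

unique-overpartitions : ∀ n → Unique (overpartitions n)
unique-overpartitions n = Unique.filter⁺ (isOverpartition? n) unique-candidates
  where
  unique-candidateParts : Unique (candidateParts n)
  unique-candidateParts = Unique.cartesianProduct⁺ (Unique.map⁺ suc-injective (Unique.upTo⁺ n))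
    (((λ ()) ∷ []) ∷ ([] ∷ []))
  lengths-disjoint : ∀ {k l} → k ≢ l → Disjoint (listsOfLength k (candidateParts n)) (listsOfLength l (candidateParts n))
  lengths-disjoint k≢l (π∈k , π∈l) =
    k≢l (trans (sym (length-∈-listsOfLength _ _ π∈k)) (length-∈-listsOfLength _ _ π∈l))
  unique-candidates : Unique (candidates n)
  unique-candidates = Unique.concat⁺ {xss = map (λ k → listsOfLength k (candidateParts n)) (upTo (suc n))}
    (AllP.map⁺ (All.tabulate {P = Unique ∘ (λ k → listsOfLength k (candidateParts n))} λ {k} (_ : k ∈ upTo (suc n)) →
      unique-listsOfLength unique-candidateParts k))
    (AllPairsP.map⁺ (AllPairs.map lengths-disjoint (Unique.upTo⁺ (suc n))))

length≤sum : ∀ {π : List Part} → All (λ p → 1 ≤ val p) π → length π ≤ sum (map val π)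
length≤sum []         = z≤n
length≤sum (1≤p ∷ ps) = +-mono-≤ 1≤p (length≤sum ps)

val≤sum : ∀ {π : List Part} {p} → p ∈ π → val p ≤ sum (map val π)
val≤sum {q ∷ π} (here refl) = m≤m+n (val q) _
val≤sum {q ∷ π} (there p∈)  = ≤-trans (val≤sum p∈) (m≤n+m _ (val q))

∈-overpartitions⁺ : ∀ {n π} → IsOverpartition n π → π ∈ overpartitions n
∈-overpartitions⁺ {n} {π} π⊢n@(positive , _ , sum≡n) = ∈-filter⁺ (isOverpartition? n) π∈candidates π⊢n
  where
  ∈-candidateParts : ∀ {p} → p ∈ π → p ∈ candidateParts n
  ∈-candidateParts {suc i , b} p∈ = ∈-cartesianProduct⁺
    (∈-map⁺ suc (∈-upTo⁺ (subst (suc i ≤_) sum≡n (val≤sum p∈))))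
    (∈-bools b)
    where
    ∈-bools : ∀ b → b ∈ true ∷ false ∷ []
    ∈-bools true  = here refl
    ∈-bools false = there (here refl)
  ∈-candidateParts {zero , b} p∈ with () ← All.lookup positive p∈
  π∈candidates : π ∈ candidates n
  π∈candidates = ∈-concat⁺′ (∈-listsOfLength _ (All.tabulate ∈-candidateParts))
    (∈-map⁺ (λ k → listsOfLength k (candidateParts n)) (∈-upTo⁺ (s≤s (subst (length π ≤_) sum≡n (length≤sum positive)))))

∈-overpartitions⁻ : ∀ {n π} → π ∈ overpartitions n → IsOverpartition n π
∈-overpartitions⁻ {n} π∈ = proj₂ (∈-filter⁻ (isOverpartition? n) {xs = candidates n} π∈)

module _ {A B : Set} where

  length-≤-injection : ∀ {xs : List A} {ys : List B} (f : A → B) → Unique xs →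
                       (∀ {x} → x ∈ xs → f x ∈ ys) →
                       (∀ {x y} → x ∈ xs → y ∈ xs → f x ≡ f y → x ≡ y) →
                       length xs ≤ length ys
  length-≤-injection {[]}     f _                  _    _   = z≤n
  length-≤-injection {x ∷ xs} f (x∉xs ∷ xs-unique) f∈ys inj
    with us , vs , refl ← ∈-∃++ (f∈ys (here refl)) = begin
      suc (length xs)         ≤⟨ s≤s (length-≤-injection f xs-unique f∈us++vs (λ y∈ z∈ → inj (there y∈) (there z∈))) ⟩
      suc (length (us ++ vs)) ≡⟨ length-++-sucʳ us (f x) vs ⟨
      length (us ++ f x ∷ vs) ∎
    where
    open ≤-Reasoning
    f∈us++vs : ∀ {y} → y ∈ xs → f y ∈ us ++ vs
    f∈us++vs {y} y∈ with ∈-++⁻ us (f∈ys (there y∈))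
    ... | inj₁ fy∈us          = ∈-++⁺ˡ fy∈us
    ... | inj₂ (here fy≡fx)   = ⊥-elim (All.lookup x∉xs y∈ (sym (inj (there y∈) (here refl) fy≡fx)))
    ... | inj₂ (there fy∈vs)  = ∈-++⁺ʳ us fy∈vs

count : ∀ {p} {P : Pred (List Part) p} → ℕ → Decidable P → ℕ
count n P? = length (filter P? (overpartitions n))

count-≤ : ∀ {p q} {P : Pred (List Part) p} {Q : Pred (List Part) q} {P? : Decidable P} {Q? : Decidable Q}
          {n n′} (f g : List Part → List Part) →
          (∀ {π} → IsOverpartition n π → P π → IsOverpartition n′ (f π) × Q (f π)) →
          (∀ {π} → IsOverpartition n π → P π → g (f π) ≡ π) →
          count n P? ≤ count n′ Q?
count-≤ {P = P} {P? = P?} {Q? = Q?} {n} {n′} f g f-into g∘f≡id = length-≤-injection f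
  (Unique.filter⁺ P? (unique-overpartitions n))
  (λ π∈ → let π⊢ , Pπ = unpack π∈ ; fπ⊢ , Qfπ = f-into π⊢ Pπ in
          ∈-filter⁺ Q? (∈-overpartitions⁺ fπ⊢) Qfπ)
  (λ π∈ σ∈ fπ≡fσ → let π⊢ , Pπ = unpack π∈ ; σ⊢ , Pσ = unpack σ∈ in
          trans (sym (g∘f≡id π⊢ Pπ)) (trans (cong g fπ≡fσ) (g∘f≡id σ⊢ Pσ)))
  where
  unpack : ∀ {π} → π ∈ filter P? (overpartitions n) → IsOverpartition n π × P π
  unpack π∈ with π∈ovp , Pπ ← ∈-filter⁻ P? {xs = overpartitions n} π∈ = ∈-overpartitions⁻ π∈ovp , Pπ

count-≡ : ∀ {p q} {P : Pred (List Part) p} {Q : Pred (List Part) q} {P? : Decidable P} {Q? : Decidable Q}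
          {n n′} (f g : List Part → List Part) →
          (∀ {π} → IsOverpartition n π → P π → IsOverpartition n′ (f π) × Q (f π)) →
          (∀ {π} → IsOverpartition n′ π → Q π → IsOverpartition n (g π) × P (g π)) →
          (∀ {π} → IsOverpartition n π → P π → g (f π) ≡ π) →
          (∀ {π} → IsOverpartition n′ π → Q π → f (g π) ≡ π) →
          count n P? ≡ count n′ Q?
count-≡ f g f-into g-into g∘f≡id f∘g≡id = ≤-antisym (count-≤ f g f-into g∘f≡id) (count-≤ g f g-into f∘g≡id)

linked : ∀ {n π} → IsOverpartition n π → Linked Step π
linked = proj₁ ∘ proj₂

mult-∷-≡ : ∀ {m p} ps → val p ≡ m → mult m (p ∷ ps) ≡ suc (mult m ps)
mult-∷-≡ {m} _ = cong length ∘ filter-accept (λ q → val q ≟ m)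

mult-∷-≢ : ∀ {m p} ps → val p ≢ m → mult m (p ∷ ps) ≡ mult m ps
mult-∷-≢ {m} _ = cong length ∘ filter-reject (λ q → val q ≟ m)

mult-↭ : ∀ m {π σ} → π ↭ σ → mult m π ≡ mult m σ
mult-↭ m = ↭-length ∘ filter-↭ (λ q → val q ≟ m)

sum-val-↭ : ∀ {π σ} → π ↭ σ → sum (map val π) ≡ sum (map val σ)
sum-val-↭ = sum-↭ ∘ ↭-map⁺ val

isOverpartition-↭⁺ : ∀ {n q π σ} → π ↭ q ∷ σ → 1 ≤ val q → Linked Step π →
                     IsOverpartition n σ → IsOverpartition (n + val q) π
isOverpartition-↭⁺ {n} {q} π↭ 1≤q π-linked (σ-positive , _ , sum≡n) =
  All-resp-↭ (↭-sym π↭) (1≤q ∷ σ-positive) , π-linked ,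
  trans (sum-val-↭ π↭) (trans (cong (val q +_) sum≡n) (+-comm (val q) n))

isOverpartition-↭⁻ : ∀ {n q π σ} → π ↭ q ∷ σ → Linked Step σ →
                     IsOverpartition (n + val q) π → IsOverpartition n σ
isOverpartition-↭⁻ {n} {q} {σ = σ} π↭ σ-linked (π-positive , _ , sum≡n+q) =
  All.tail (All-resp-↭ π↭ π-positive) , σ-linked ,
  +-cancelʳ-≡ (val q) (sum (map val σ)) n
    (trans (+-comm _ (val q)) (trans (sym (sum-val-↭ π↭)) sum≡n+q))

tail-≤-head : ∀ {p ps} → Linked Step (p ∷ ps) → All (λ q → val q ≤ val p) ps
tail-≤-head [-]             = []
tail-≤-head ((q≤p , _) ∷ l) = q≤p ∷ All.map (λ r≤q → ≤-trans r≤q q≤p) (tail-≤-head l)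

∈⇒1≤mult : ∀ {x π} → x ∈ π → 1 ≤ mult (val x) π
∈⇒1≤mult {π = p ∷ ps} (here refl) = subst (1 ≤_) (sym (mult-∷-≡ {p = p} ps refl)) (s≤s z≤n)
∈⇒1≤mult {x} {p ∷ ps} (there x∈) with does (val p ≟ val x) | proof (val p ≟ val x)
... | true  | _ = s≤s z≤n
... | false | _ = ∈⇒1≤mult x∈

1≤mult⇒∈ : ∀ {m π} → 1 ≤ mult m π → ∃ λ b → (m , b) ∈ π
1≤mult⇒∈ {m} {p ∷ ps} 1≤mult with does (val p ≟ m) | proof (val p ≟ m)
... | true  | ofʸ refl = over p , here refl
... | false | _        = let b , m∈ = 1≤mult⇒∈ 1≤mult in b , there m∈

mult*≤sum : ∀ m π → mult m π * m ≤ sum (map val π)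
mult*≤sum m []       = z≤n
mult*≤sum m (p ∷ ps) with does (val p ≟ m) | proof (val p ≟ m)
... | true  | ofʸ refl = +-monoʳ-≤ (val p) (mult*≤sum m ps)
... | false | _        = ≤-trans (mult*≤sum m ps) (m≤n+m _ (val p))

mult-↭-∷ : ∀ {m b π σ} → π ↭ (m , b) ∷ σ → mult m π ≡ suc (mult m σ)
mult-↭-∷ {σ = σ} π↭ = trans (mult-↭ _ π↭) (mult-∷-≡ σ refl)

addCopy : ℕ → List Part → List Part
addCopy m []       = []
addCopy m (p ∷ ps) = p ∷ (if does (val p ≟ m) then (m , false) ∷ ps else addCopy m ps)

dropCopy : ℕ → List Part → List Part
dropCopy m []       = []
dropCopy m (p ∷ ps) = p ∷ (if does (val p ≟ m) then drop 1 ps else dropCopy m ps)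

dropCopy-addCopy : ∀ m π → dropCopy m (addCopy m π) ≡ π
dropCopy-addCopy m []       = refl
dropCopy-addCopy m (p ∷ ps) with does (val p ≟ m)
... | true  = refl
... | false = cong (p ∷_) (dropCopy-addCopy m ps)

addCopy-↭ : ∀ {m} π → 1 ≤ mult m π → addCopy m π ↭ (m , false) ∷ π
addCopy-↭ {m} (p ∷ ps) 1≤mult with does (val p ≟ m)
... | true  = ↭-swap p (m , false) ↭-refl
... | false = ↭-trans (↭-prep p (addCopy-↭ ps 1≤mult)) (↭-swap p (m , false) ↭-refl)

addCopy-linked : ∀ {m π} → Linked Step π → Linked Step (addCopy m π)
addCopy-linked [] = []
addCopy-linked {m} {p ∷ []} [-] with does (val p ≟ m) | proof (val p ≟ m)
... | true  | ofʸ refl = (≤-refl , λ _ → refl) ∷ [-]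
... | false | _        = [-]
addCopy-linked {m} {p ∷ _ ∷ _} (p~q ∷ l) with does (val p ≟ m) | proof (val p ≟ m)
... | true  | ofʸ refl = (≤-refl , λ _ → refl) ∷ p~q ∷ l
... | false | _        = p~q ∷ addCopy-linked l

later-copy-plain : ∀ {p ps} → Linked Step (p ∷ ps) → 1 ≤ mult (val p) ps →
                   ∃ λ qs → ps ≡ (val p , false) ∷ qs
later-copy-plain {p} {q ∷ qs} ((q≤p , q-plain) ∷ l) 1≤mult
  with does (val q ≟ val p) | proof (val q ≟ val p)
... | true  | ofʸ q≡p = qs , cong (_∷ qs) (cong₂ _,_ q≡p (q-plain q≡p))
... | false | ofⁿ q≢p = let _ , p∈qs = 1≤mult⇒∈ 1≤mult in contradiction (All.lookup qs<p p∈qs) (<-irrefl refl)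
  where
  qs<p : All (λ r → val r < val p) qs
  qs<p = All.map (λ r≤q → ≤-<-trans r≤q (≤∧≢⇒< q≤p q≢p)) (tail-≤-head l)

module _ {m : ℕ} where

  dropCopy-↭ : ∀ {π} → Linked Step π → 2 ≤ mult m π → π ↭ (m , false) ∷ dropCopy m π
  dropCopy-↭ {p ∷ ps} l 2≤mult with does (val p ≟ m) | proof (val p ≟ m)
  ... | true  | ofʸ refl with qs , refl ← later-copy-plain l (s≤s⁻¹ 2≤mult) = ↭-swap p (m , false) ↭-refl
  ... | false | _ = ↭-trans (↭-prep p (dropCopy-↭ (Linked.tail l) 2≤mult)) (↭-swap p (m , false) ↭-refl)

  dropCopy-linked : ∀ {π} → Linked Step π → 2 ≤ mult m π → Linked Step (dropCopy m π)
  dropCopy-linked {p ∷ ps} l 2≤mult with does (val p ≟ m) | proof (val p ≟ m)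
  ... | true  | ofʸ refl with qs , refl ← later-copy-plain l (s≤s⁻¹ 2≤mult) = skip-copy l
    where
    skip-copy : ∀ {qs} → Linked Step (p ∷ (val p , false) ∷ qs) → Linked Step (p ∷ qs)
    skip-copy (_ ∷ [-])      = [-]
    skip-copy (_ ∷ p~q ∷ l′) = p~q ∷ l′
  dropCopy-linked {p ∷ q ∷ qs} (p~q ∷ l) 2≤mult | false | _ = p~q ∷ dropCopy-linked l 2≤mult

  addCopy-dropCopy : ∀ {π} → Linked Step π → 2 ≤ mult m π → addCopy m (dropCopy m π) ≡ π
  addCopy-dropCopy {p ∷ ps} l 2≤mult with does (val p ≟ m) | proof (val p ≟ m)
  ... | true  | ofʸ refl with qs , refl ← later-copy-plain l (s≤s⁻¹ 2≤mult) = refl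
  ... | false | _ = cong (p ∷_) (addCopy-dropCopy (Linked.tail l) 2≤mult)

insertPart : Part → List Part → List Part
insertPart q []       = q ∷ []
insertPart q (p ∷ ps) = if does (val q <? val p) then p ∷ insertPart q ps else q ∷ p ∷ ps

removePart : ℕ → List Part → List Part
removePart m []       = []
removePart m (p ∷ ps) = if does (val p ≟ m) then ps else p ∷ removePart m ps

fresh-below : ∀ {m ps} → All (λ q → val q ≤ m) ps → mult m ps ≡ 0 → All (λ q → val q < m) ps
fresh-below {ps = ps} ps≤m mult≡0 = All.tabulate λ q∈ → ≤∧≢⇒< (All.lookup ps≤m q∈)
  λ { refl → contradiction (subst (1 ≤_) mult≡0 (∈⇒1≤mult q∈)) λ () }

step-< : ∀ {p q} → val q < val p → Step p q
step-< q<p = <⇒≤ q<p , λ q≡p → contradiction q≡p (<⇒≢ q<p)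

step-fresh : ∀ {q p ps} → mult (val q) (p ∷ ps) ≡ 0 → val p ≤ val q → Step q p
step-fresh {ps = ps} mult≡0 p≤q = p≤q , λ p≡q → contradiction (trans (sym (mult-∷-≡ ps p≡q)) mult≡0) λ ()

removePart-insertPart : ∀ q π → removePart (val q) (insertPart q π) ≡ π
removePart-insertPart q [] rewrite dec-true (val q ≟ val q) refl = refl
removePart-insertPart q (p ∷ ps) with does (val q <? val p) | proof (val q <? val p)
... | false | _ rewrite dec-true (val q ≟ val q) refl = refl
... | true  | ofʸ q<p rewrite dec-false (val p ≟ val q) (<⇒≢ q<p ∘ sym) = cong (p ∷_) (removePart-insertPart q ps)

insertPart-↭ : ∀ q π → insertPart q π ↭ q ∷ π
insertPart-↭ q []       = ↭-refl
insertPart-↭ q (p ∷ ps) with does (val q <? val p)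
... | true  = ↭-trans (↭-prep p (insertPart-↭ q ps)) (↭-swap p q ↭-refl)
... | false = ↭-refl

insertPart-all< : ∀ {q} ps → All (λ p → val p < val q) ps → insertPart q ps ≡ q ∷ ps
insertPart-all< []             _             = refl
insertPart-all< {q} (p ∷ _) (p<q ∷ _) with does (val q <? val p) | proof (val q <? val p)
... | true  | ofʸ q<p = contradiction p<q (<-asym q<p)
... | false | _       = refl

insertPart-linked-∷ : ∀ {r q π} → val q < val r → Linked Step (r ∷ π) → mult (val q) π ≡ 0 →
                      Linked Step (r ∷ insertPart q π)
insertPart-linked-∷ {r} {q} q<r [-] _ = step-< {r} {q} q<r ∷ [-]
insertPart-linked-∷ {r} {q} {p ∷ ps} q<r (r~p ∷ l) mult≡0 with does (val q <? val p) | proof (val q <? val p)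
... | true  | ofʸ q<p = r~p ∷ insertPart-linked-∷ q<p l (trans (sym (mult-∷-≢ ps (<⇒≢ q<p ∘ sym))) mult≡0)
... | false | ofⁿ q≮p = step-< {r} {q} q<r ∷ step-fresh {q} mult≡0 (≮⇒≥ q≮p) ∷ l

insertPart-linked : ∀ {q π} → Linked Step π → mult (val q) π ≡ 0 → Linked Step (insertPart q π)
insertPart-linked []                     _      = [-]
insertPart-linked {q} {p ∷ ps} l mult≡0 with does (val q <? val p) | proof (val q <? val p)
... | true  | ofʸ q<p = insertPart-linked-∷ q<p l (trans (sym (mult-∷-≢ ps (<⇒≢ q<p ∘ sym))) mult≡0)
... | false | ofⁿ q≮p = step-fresh {q} mult≡0 (≮⇒≥ q≮p) ∷ l

module _ {m : ℕ} where

  removePart-↭ : ∀ {b π} → (m , b) ∈ π → mult m π ≡ 1 → π ↭ (m , b) ∷ removePart m π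
  removePart-↭ {b} {p ∷ ps} m∈ mult≡1 with does (val p ≟ m) | proof (val p ≟ m) | m∈
  ... | true  | _       | here refl   = ↭-refl
  ... | true  | ofʸ refl | there m∈ps = contradiction (subst (1 ≤_) (suc-injective mult≡1) (∈⇒1≤mult m∈ps)) λ ()
  ... | false | ofⁿ p≢m | here refl   = contradiction refl p≢m
  ... | false | _       | there m∈ps = ↭-trans (↭-prep p (removePart-↭ m∈ps mult≡1)) (↭-swap p (m , b) ↭-refl)

  removePart-linked-∷ : ∀ {r π} → Linked Step (r ∷ π) → mult m π ≡ 1 → Linked Step (r ∷ removePart m π)
  removePart-linked-∷ {r} {p ∷ ps} (r~p ∷ l) mult≡1 with does (val p ≟ m) | proof (val p ≟ m)
  ... | false | _ = r~p ∷ removePart-linked-∷ l mult≡1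
  ... | true  | ofʸ refl with ps | l
  ...   | []     | _             = [-]
  ...   | q ∷ qs | (q≤p , _) ∷ l′ = step-< {r} {q} (<-≤-trans q<p (proj₁ r~p)) ∷ l′
    where
    q<p : val q < val p
    q<p = ≤∧≢⇒< q≤p λ q≡p → contradiction (trans (sym (mult-∷-≡ qs q≡p)) (suc-injective mult≡1)) λ ()

  removePart-linked : ∀ {π} → Linked Step π → mult m π ≡ 1 → Linked Step (removePart m π)
  removePart-linked {p ∷ ps} l mult≡1 with does (val p ≟ m)
  ... | true  = Linked.tail l
  ... | false = removePart-linked-∷ l mult≡1

  insertPart-removePart : ∀ {b π} → Linked Step π → mult m π ≡ 1 → (m , b) ∈ π →
                          insertPart (m , b) (removePart m π) ≡ π
  insertPart-removePart {b} {p ∷ ps} l mult≡1 m∈ with does (val p ≟ m) | proof (val p ≟ m) | m∈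
  ... | true  | _        | here refl  = insertPart-all< ps (fresh-below (tail-≤-head l) (suc-injective mult≡1))
  ... | true  | ofʸ refl | there m∈ps = contradiction (subst (1 ≤_) (suc-injective mult≡1) (∈⇒1≤mult m∈ps)) λ ()
  ... | false | ofⁿ p≢m  | here refl  = contradiction refl p≢m
  ... | false | ofⁿ p≢m  | there m∈ps with does (m <? val p) | proof (m <? val p)
  ...   | true  | _       = cong (p ∷_) (insertPart-removePart (Linked.tail l) mult≡1 m∈ps)
  ...   | false | ofⁿ m≮p = contradiction (≤∧≢⇒< (All.lookup (tail-≤-head l) m∈ps) (p≢m ∘ sym)) m≮p

atLeast : ℕ → ℕ → ℕ → ℕ
atLeast k m n = count n (λ π → k ≤? mult m π)

module _ (m : ℕ) where

  absent? : (π : List Part) → Dec (mult m π ≡ 0)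
  absent? π = mult m π ≟ 0

  overlinedOnce? : (π : List Part) → Dec (mult m π ≡ 1 × (m , true) ∈ π)
  overlinedOnce? π = (mult m π ≟ 1) ×-dec ((m , true) ∈? π)

  plainOnce? : (π : List Part) → Dec (mult m π ≡ 1 × (m , true) ∉ π)
  plainOnce? π = (mult m π ≟ 1) ×-dec ¬? ((m , true) ∈? π)

atLeast-+ : ∀ c {m} n → 1 ≤ m → atLeast (2 + c) m (n + m) ≡ atLeast (1 + c) m n
atLeast-+ c {m} n 1≤m = count-≡ (dropCopy m) (addCopy m) dropCopy-into addCopy-into
  (λ π⊢ → addCopy-dropCopy (linked π⊢) ∘ at-least-two)
  (λ {σ} _ _ → dropCopy-addCopy m σ)
  where
  at-least-two : ∀ {k} → 2 + c ≤ k → 2 ≤ k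
  at-least-two = ≤-trans (s≤s (s≤s z≤n))

  dropCopy-into : ∀ {π} → IsOverpartition (n + m) π → 2 + c ≤ mult m π →
                  IsOverpartition n (dropCopy m π) × 1 + c ≤ mult m (dropCopy m π)
  dropCopy-into π⊢ c+2≤mult =
    isOverpartition-↭⁻ π↭ (dropCopy-linked (linked π⊢) (at-least-two c+2≤mult)) π⊢ ,
    s≤s⁻¹ (subst (2 + c ≤_) (mult-↭-∷ π↭) c+2≤mult)
    where π↭ = dropCopy-↭ (linked π⊢) (at-least-two c+2≤mult)

  addCopy-into : ∀ {σ} → IsOverpartition n σ → 1 + c ≤ mult m σ →
                 IsOverpartition (n + m) (addCopy m σ) × 2 + c ≤ mult m (addCopy m σ)
  addCopy-into {σ} σ⊢ c+1≤mult =
    isOverpartition-↭⁺ σ↭ 1≤m (addCopy-linked (linked σ⊢)) σ⊢ ,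
    subst (2 + c ≤_) (sym (mult-↭-∷ σ↭)) (s≤s c+1≤mult)
    where σ↭ = addCopy-↭ σ (≤-trans (s≤s z≤n) c+1≤mult)

module _ {m : ℕ} (1≤m : 1 ≤ m) where

  insertPart-fresh : ∀ {n b σ} → IsOverpartition n σ → mult m σ ≡ 0 →
                     IsOverpartition (n + m) (insertPart (m , b) σ) × mult m (insertPart (m , b) σ) ≡ 1
  insertPart-fresh {b = b} {σ} σ⊢ mult≡0 =
    isOverpartition-↭⁺ (insertPart-↭ _ σ) 1≤m (insertPart-linked (linked σ⊢) mult≡0) σ⊢ ,
    trans (mult-↭-∷ (insertPart-↭ (m , b) σ)) (cong suc mult≡0)

  removePart-unique : ∀ {n b π} → IsOverpartition (n + m) π → mult m π ≡ 1 → (m , b) ∈ π →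
                      IsOverpartition n (removePart m π) × mult m (removePart m π) ≡ 0
  removePart-unique π⊢ mult≡1 m∈ =
    isOverpartition-↭⁻ π↭ (removePart-linked (linked π⊢) mult≡1) π⊢ ,
    suc-injective (trans (sym (mult-↭-∷ π↭)) mult≡1)
    where π↭ = removePart-↭ m∈ mult≡1

  count-overlinedOnce : ∀ n → count (n + m) (overlinedOnce? m) ≡ count n (absent? m)
  count-overlinedOnce n = count-≡ {P? = overlinedOnce? m} {Q? = absent? m} {n + m} {n} (removePart m) (insertPart (m , true))
    (λ π⊢ (mult≡1 , m∈) → removePart-unique π⊢ mult≡1 m∈)
    (λ {σ} σ⊢ mult≡0 → let σ′⊢ , mult≡1 = insertPart-fresh σ⊢ mult≡0 in
       σ′⊢ , mult≡1 , Any-resp-↭ (↭-sym (insertPart-↭ (m , true) σ)) (here refl))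
    (λ π⊢ (mult≡1 , m∈) → insertPart-removePart (linked π⊢) mult≡1 m∈)
    (λ {σ} _ _ → removePart-insertPart (m , true) σ)

  count-plainOnce : ∀ n → count (n + m) (plainOnce? m) ≡ count n (absent? m)
  count-plainOnce n = count-≡ {P? = plainOnce? m} {Q? = absent? m} {n + m} {n} (removePart m) (insertPart (m , false))
    (λ π⊢ (mult≡1 , m∉) → removePart-unique π⊢ mult≡1 (plain∈ mult≡1 m∉))
    (λ {σ} σ⊢ mult≡0 → let σ′⊢ , mult≡1 = insertPart-fresh σ⊢ mult≡0 in σ′⊢ , mult≡1 , overlined∉ {σ} mult≡0)
    (λ π⊢ (mult≡1 , m∉) → insertPart-removePart (linked π⊢) mult≡1 (plain∈ mult≡1 m∉))
    (λ {σ} _ _ → removePart-insertPart (m , false) σ)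
    where
    plain∈ : ∀ {π} → mult m π ≡ 1 → (m , true) ∉ π → (m , false) ∈ π
    plain∈ mult≡1 m∉ with 1≤mult⇒∈ (≤-reflexive (sym mult≡1))
    ... | true  , m∈ = contradiction m∈ m∉
    ... | false , m∈ = m∈
    overlined∉ : ∀ {σ} → mult m σ ≡ 0 → (m , true) ∉ insertPart (m , false) σ
    overlined∉ {σ} mult≡0 m∈ with Any-resp-↭ (insertPart-↭ _ σ) m∈
    ... | there m∈σ = contradiction (subst (1 ≤_) mult≡0 (∈⇒1≤mult m∈σ)) λ ()

atLeast-< : ∀ c {m n} → n < m → atLeast (suc c) m n ≡ 0
atLeast-< c {m} {n} n<m = cong length (filter-none (λ π → suc c ≤? mult m π)
  (All.tabulate λ π∈ → too-many (∈-overpartitions⁻ π∈)))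
  where
  too-many : ∀ {π} → IsOverpartition n π → ¬ suc c ≤ mult m π
  too-many {π} (_ , _ , sum≡n) c+1≤mult with mult m π | mult*≤sum m π
  ... | zero  | _        = contradiction c+1≤mult λ ()
  ... | suc j | mult*m≤n = <⇒≱ n<m (≤-trans (m≤m+n m (j * m)) (subst (m + j * m ≤_) sum≡n mult*m≤n))

indicator-×-¬ : ∀ {a b} {A : Set a} {B : Set b} (A? : Dec A) (B? : Dec B) →
                indicator A? ≡ indicator (A? ×-dec B?) + indicator (A? ×-dec ¬? B?)
indicator-×-¬ (false because _) _                 = refl
indicator-×-¬ (true  because _) (true  because _) = refl
indicator-×-¬ (true  because _) (false because _) = refl

indicator-1≤ : ∀ k → indicator (1 ≤? k) ≡ indicator (k ≟ 1) + indicator (2 ≤? k)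
indicator-1≤ zero          = refl
indicator-1≤ (suc zero)    = refl
indicator-1≤ (suc (suc k)) = refl

indicator-0≤ : ∀ k → 1 ≡ indicator (k ≟ 0) + indicator (1 ≤? k)
indicator-0≤ zero    = refl
indicator-0≤ (suc k) = refl

p̄ : ℕ → ℕ
p̄ n = length (overpartitions n)

-- p̄(n − d), with the value 0 when d > n
p̄[_-_] : ℕ → ℕ → ℕ
p̄[ n     - zero  ] = p̄ n
p̄[ zero  - suc d ] = 0
p̄[ suc n - suc d ] = p̄[ n - d ]

p̄[-]-< : ∀ {n d} → n < d → p̄[ n - d ] ≡ 0
p̄[-]-< {zero}  {suc d} _         = refl
p̄[-]-< {suc n} {suc d} (s≤s n<d) = p̄[-]-< n<d

p̄[+-+] : ∀ n d k → p̄[ n + k - d + k ] ≡ p̄[ n - d ]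
p̄[+-+] n d zero    rewrite +-identityʳ n | +-identityʳ d = refl
p̄[+-+] n d (suc k) rewrite +-suc n k | +-suc d k = p̄[+-+] n d k

<⊎+ : ∀ m n → n < m ⊎ ∃ λ k → n ≡ k + m
<⊎+ m n with m ≤? n
... | yes m≤n = inj₂ (n ∸ m , sym (m∸n+n≡m m≤n))
... | no  m≰n = inj₁ (≰⇒> m≰n)

module _ {m : ℕ} (1≤m : 1 ≤ m) where

  p̄-split : ∀ n → p̄ n ≡ count n (absent? m) + atLeast 1 m n
  p̄-split n = begin
    length (overpartitions n)
      ≡⟨ cong length (filter-all ⊤? {xs = overpartitions n} (All.tabulate λ _ → tt)) ⟨
    length (filter ⊤? (overpartitions n))
      ≡⟨ length-filter-+ ⊤? (absent? m) (λ σ → 1 ≤? mult m σ) (overpartitions n) (indicator-0≤ ∘ mult m) ⟩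
    count n (absent? m) + atLeast 1 m n ∎
    where
    open ≡-Reasoning
    ⊤? : Decidable {A = List Part} (λ _ → ⊤)
    ⊤? _ = yes tt

  atLeast-1-split : ∀ n → atLeast 1 m n ≡ count n (overlinedOnce? m) + count n (plainOnce? m) + atLeast 2 m n
  atLeast-1-split n = begin
    atLeast 1 m n
      ≡⟨ length-filter-+ (λ π → 1 ≤? mult m π) (λ π → mult m π ≟ 1) (λ π → 2 ≤? mult m π) (overpartitions n) (indicator-1≤ ∘ mult m) ⟩
    count n (λ π → mult m π ≟ 1) + atLeast 2 m n
      ≡⟨ cong (_+ atLeast 2 m n) (length-filter-+ (λ π → mult m π ≟ 1) (overlinedOnce? m) (plainOnce? m) (overpartitions n)
           λ π → indicator-×-¬ (mult m π ≟ 1) ((m , true) ∈? π)) ⟩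
    count n (overlinedOnce? m) + count n (plainOnce? m) + atLeast 2 m n ∎
    where open ≡-Reasoning

  atLeast-1-+ : ∀ n → atLeast 1 m (n + m) + atLeast 1 m n ≡ 2 * p̄ n
  atLeast-1-+ n = begin
    atLeast 1 m (n + m) + a
      ≡⟨ cong (_+ a) (atLeast-1-split (n + m)) ⟩
    count (n + m) (overlinedOnce? m) + count (n + m) (plainOnce? m) + atLeast 2 m (n + m) + a
      ≡⟨ cong (_+ a) (cong₂ _+_ (cong₂ _+_ (count-overlinedOnce 1≤m n) (count-plainOnce 1≤m n)) (atLeast-+ 0 n 1≤m)) ⟩
    z + z + a + a
      ≡⟨ solve 2 (λ z a → z :+ z :+ a :+ a := con 2 :* (z :+ a)) refl z a ⟩
    2 * (z + a)
      ≡⟨ cong (2 *_) (p̄-split n) ⟨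
    2 * p̄ n ∎
    where
    open ≡-Reasoning
    open +-*-Solver
    z = count n (absent? m)
    a = atLeast 1 m n

  atLeast-1+2 : ∀ n → atLeast 1 m n + atLeast 2 m n ≡ 2 * p̄[ n - m ]
  atLeast-1+2 n with <⊎+ m n
  ... | inj₁ n<m rewrite atLeast-< 0 n<m | atLeast-< 1 n<m | p̄[-]-< n<m = refl
  ... | inj₂ (k , refl) = begin
    atLeast 1 m (k + m) + atLeast 2 m (k + m) ≡⟨ cong (atLeast 1 m (k + m) +_) (atLeast-+ 0 k 1≤m) ⟩
    atLeast 1 m (k + m) + atLeast 1 m k       ≡⟨ atLeast-1-+ k ⟩
    2 * p̄ k                                   ≡⟨ cong (2 *_) (p̄[+-+] k 0 m) ⟨
    2 * p̄[ k + m - m ]                        ∎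
    where open ≡-Reasoning

  atLeast-2+3 : ∀ n → atLeast 2 m n + atLeast 3 m n ≡ 2 * p̄[ n - m + m ]
  atLeast-2+3 n with <⊎+ m n
  ... | inj₁ n<m rewrite atLeast-< 1 n<m | atLeast-< 2 n<m | p̄[-]-< (<-≤-trans n<m (m≤m+n m m)) = refl
  ... | inj₂ (k , refl) = begin
    atLeast 2 m (k + m) + atLeast 3 m (k + m) ≡⟨ cong₂ _+_ (atLeast-+ 0 k 1≤m) (atLeast-+ 1 k 1≤m) ⟩
    atLeast 1 m k + atLeast 2 m k             ≡⟨ atLeast-1+2 k ⟩
    2 * p̄[ k - m ]                            ≡⟨ cong (2 *_) (p̄[+-+] k m m) ⟨
    2 * p̄[ k + m - m + m ]                    ∎
    where open ≡-Reasoning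

  atLeast-1-3 : ∀ n → atLeast 1 m n + 2 * p̄[ n - m + m ] ≡ atLeast 3 m n + 2 * p̄[ n - m ]
  atLeast-1-3 n = begin
    atLeast 1 m n + 2 * p̄[ n - m + m ]            ≡⟨ cong (atLeast 1 m n +_) (atLeast-2+3 n) ⟨
    atLeast 1 m n + (atLeast 2 m n + atLeast 3 m n) ≡⟨ +-assoc (atLeast 1 m n) _ _ ⟨
    atLeast 1 m n + atLeast 2 m n + atLeast 3 m n   ≡⟨ cong (_+ atLeast 3 m n) (atLeast-1+2 n) ⟩
    2 * p̄[ n - m ] + atLeast 3 m n                 ≡⟨ +-comm _ (atLeast 3 m n) ⟩
    atLeast 3 m n + 2 * p̄[ n - m ]                 ∎
    where open ≡-Reasoning

∑-indicator-≤ : ∀ {k} n → k ≤ n → ∑[ i < n ] indicator (suc i ≤? k) ≡ k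
∑-indicator-≤ {zero}  n       _         = ∑-zero n
  where
  ∑-zero : ∀ n → ∑[ i < n ] 0 ≡ 0
  ∑-zero zero    = refl
  ∑-zero (suc n) = ∑-zero n
∑-indicator-≤ {suc k} (suc n) (s≤s k≤n) = cong suc (∑-indicator-≤ {k} n k≤n)

Gbar≡∑ : ∀ k n → Gbar k n ≡ ∑[ i < n ] atLeast k (suc i) n
Gbar≡∑ k n = trans (double-counting (λ π m → k ≤? mult m π) (overpartitions n) (map suc (upTo n)))
                   (sum-map-positives n (λ m → atLeast k m n))

F1bar≡∑ : ∀ n → F1bar n ≡ ∑[ i < n ] atLeast (suc i) 1 n
F1bar≡∑ n = begin
  sum (map (mult 1) (overpartitions n))
    ≡⟨ sum-map-cong (overpartitions n) (mult≡count ∘ ∈-overpartitions⁻) ⟩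
  sum (map (λ π → length (filter (λ c → c ≤? mult 1 π) (map suc (upTo n)))) (overpartitions n))
    ≡⟨ double-counting (λ π c → c ≤? mult 1 π) (overpartitions n) (map suc (upTo n)) ⟩
  sum (map (λ c → atLeast c 1 n) (map suc (upTo n)))
    ≡⟨ sum-map-positives n (λ c → atLeast c 1 n) ⟩
  ∑[ i < n ] atLeast (suc i) 1 n ∎
  where
  open ≡-Reasoning
  mult≡count : ∀ {π} → IsOverpartition n π → mult 1 π ≡ length (filter (λ c → c ≤? mult 1 π) (map suc (upTo n)))
  mult≡count {π} (_ , _ , sum≡n) = sym (begin
    length (filter (λ c → c ≤? mult 1 π) (map suc (upTo n)))  ≡⟨ length-filter-indicator _ (map suc (upTo n)) ⟩
    sum (map (λ c → indicator (c ≤? mult 1 π)) (map suc (upTo n))) ≡⟨ sum-map-positives n _ ⟩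
    ∑[ i < n ] indicator (suc i ≤? mult 1 π)                  ≡⟨ ∑-indicator-≤ n mult≤n ⟩
    mult 1 π                                                  ∎)
    where
    mult≤n : mult 1 π ≤ n
    mult≤n = subst₂ _≤_ (*-identityʳ (mult 1 π)) sum≡n (mult*≤sum 1 π)

G : ℕ → ℕ → ℕ
G k n = ∑[ i < n ] atLeast k (suc i) n

F : ℕ → ℕ
F n = ∑[ i < n ] atLeast (suc i) 1 n

S : ℕ → ℕ
S n = ∑[ i < n ] p̄[ n - suc i ]

E : ℕ → ℕ
E n = ∑[ i < n ] p̄[ n - suc i + suc i ]

G₁+2E≡G₃+2S : ∀ n → G 1 n + 2 * E n ≡ G 3 n + 2 * S n
G₁+2E≡G₃+2S n = begin
  G 1 n + 2 * E n                                          ≡⟨ cong (G 1 n +_) (∑-*ˡ n 2 _) ⟨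
  G 1 n + ∑[ i < n ] (2 * p̄[ n - suc i + suc i ])          ≡⟨ ∑-+ n _ _ ⟨
  ∑[ i < n ] (atLeast 1 (suc i) n + 2 * p̄[ n - suc i + suc i ]) ≡⟨ ∑-cong n (λ _ → atLeast-1-3 (s≤s z≤n) n) ⟩
  ∑[ i < n ] (atLeast 3 (suc i) n + 2 * p̄[ n - suc i ])    ≡⟨ ∑-+ n _ _ ⟩
  G 3 n + ∑[ i < n ] (2 * p̄[ n - suc i ])                  ≡⟨ cong (G 3 n +_) (∑-*ˡ n 2 _) ⟩
  G 3 n + 2 * S n                                          ∎
  where open ≡-Reasoning

F-suc : ∀ n → F (suc n) ≡ atLeast 1 1 (suc n) + F n
F-suc n = cong (atLeast 1 1 (suc n) +_) (∑-cong n λ {i} _ →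
  trans (cong (atLeast (2 + i) 1) (+-comm 1 n)) (atLeast-+ i n ≤-refl))

E-suc-suc : ∀ n → E (2 + n) ≡ p̄ n + E n
E-suc-suc n = cong (p̄ n +_) (begin
  ∑[ i < suc n ] p̄[ n - i + suc (suc i) ]   ≡⟨ ∑-cong (suc n) (λ {i} _ → cong p̄[ n -_] (+-suc i (suc i))) ⟩
  ∑[ i < suc n ] p̄[ n - suc i + suc i ]     ≡⟨ ∑-suc n _ ⟩
  E n + p̄[ n - suc n + suc n ]              ≡⟨ cong (E n +_) (p̄[-]-< (≤-trans (n<1+n n) (m≤m+n (suc n) (suc n)))) ⟩
  E n + 0                                   ≡⟨ +-identityʳ (E n) ⟩
  E n                                       ∎)
  where open ≡-Reasoning

F+2E≡2S : ∀ n → F n + 2 * E n ≡ 2 * S n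
F+2E≡2S zero          = refl
F+2E≡2S (suc zero)    = refl  -- by evaluation: F̄₁(1) = 2 = 2 p̄(0)
F+2E≡2S (suc (suc n)) = begin
  F (2 + n) + 2 * E (2 + n)
    ≡⟨ cong₂ (λ x y → x + 2 * y) (trans (F-suc (suc n)) (cong (a₂ +_) (F-suc n))) (E-suc-suc n) ⟩
  a₂ + (a₁ + F n) + 2 * (p̄ n + E n)
    ≡⟨ solve 5 (λ a₂ a₁ f p e → a₂ :+ (a₁ :+ f) :+ con 2 :* (p :+ e) := (a₂ :+ a₁) :+ (f :+ con 2 :* e) :+ con 2 :* p)
             refl a₂ a₁ (F n) (p̄ n) (E n) ⟩
  (a₂ + a₁) + (F n + 2 * E n) + 2 * p̄ n
    ≡⟨ cong₂ (λ x y → x + y + 2 * p̄ n) a₂+a₁ (F+2E≡2S n) ⟩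
  2 * p̄ (suc n) + 2 * S n + 2 * p̄ n
    ≡⟨ solve 3 (λ q s p → con 2 :* q :+ con 2 :* s :+ con 2 :* p := con 2 :* (q :+ (p :+ s))) refl (p̄ (suc n)) (S n) (p̄ n) ⟩
  2 * S (2 + n) ∎
  where
  open ≡-Reasoning
  open +-*-Solver
  a₂ = atLeast 1 1 (2 + n)
  a₁ = atLeast 1 1 (1 + n)
  a₂+a₁ : a₂ + a₁ ≡ 2 * p̄ (suc n)
  a₂+a₁ = trans (cong (λ k → atLeast 1 1 k + a₁) (+-comm 1 (suc n))) (atLeast-1-+ ≤-refl (suc n))

G₁≡G₃+F : ∀ n → G 1 n ≡ G 3 n + F n
G₁≡G₃+F n = +-cancelʳ-≡ (2 * E n) (G 1 n) (G 3 n + F n) (begin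
  G 1 n + 2 * E n         ≡⟨ G₁+2E≡G₃+2S n ⟩
  G 3 n + 2 * S n         ≡⟨ cong (G 3 n +_) (F+2E≡2S n) ⟨
  G 3 n + (F n + 2 * E n) ≡⟨ +-assoc (G 3 n) (F n) _ ⟨
  G 3 n + F n + 2 * E n   ∎)
  where open ≡-Reasoning

Gbar₁≡Gbar₃+F1bar : ∀ n → Gbar 1 n ≡ Gbar 3 n + F1bar n
Gbar₁≡Gbar₃+F1bar n = begin
  Gbar 1 n            ≡⟨ Gbar≡∑ 1 n ⟩
  G 1 n               ≡⟨ G₁≡G₃+F n ⟩
  G 3 n + F n         ≡⟨ cong₂ _+_ (Gbar≡∑ 3 n) (F1bar≡∑ n) ⟨
  Gbar 3 n + F1bar n  ∎
  where open ≡-Reasoning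

open import Data.Integer using (+_; _-_; _⊖_)
open import Data.Integer.Properties using (⊖-≥; [+m]-[+n]≡m⊖n)

+[m+n]-+m : ∀ m n → + (m + n) - + m ≡ + n
+[m+n]-+m m n = begin
  + (m + n) - + m  ≡⟨ [+m]-[+n]≡m⊖n (m + n) m ⟩
  (m + n) ⊖ m      ≡⟨ ⊖-≥ (m≤m+n m n) ⟩
  + (m + n ∸ m)    ≡⟨ cong +_ (m+n∸m≡n m n) ⟩
  + n              ∎
  where open ≡-Reasoning

theorem8 : (n : ℕ) → 1 ≤ n → + F1bar n ≡ + Gbar 1 n - + Gbar 3 n
theorem8 n _ = begin
  + F1bar n                           ≡⟨ +[m+n]-+m (Gbar 3 n) (F1bar n) ⟨
  + (Gbar 3 n + F1bar n) - + Gbar 3 n ≡⟨ cong (λ g → + g - + Gbar 3 n) (Gbar₁≡Gbar₃+F1bar n) ⟨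
  + Gbar 1 n - + Gbar 3 n             ∎
  where open ≡-Reasoning
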